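{- For every positive integer $n$, let $p\in\{0,1\}^k$ be the binary expansion of $n$ (so $p[1]=1$ and $k=\lfloor \log_2 n\rfloor+1$). Then $|a[1,n]|_{pal}$ equals the minimal number of masque operations of type $A$ of length $k$ whose successive application transforms $p$ into the word $0^k$. As a result, $|a[1,n]|_{pal}=c[n]$.
   Context: The ruler sequence $(a[n])_{n\ge 1}$ is defined by $a[n]=$ the exponent of the highest power of $2$ dividing $n$ (the $2$-adic valuation of $n$); its first terms are $0,1,0,2,0,1,0,3,\dots$. For a word $x$ and $i\le j$, $x[i,j]=x[i]x[i+1]\cdots x[j]$. A word $w$ is a palindrome if it equals its reversal; $|w|_{pal}$ is the minimal $m$ such that $w=w_1w_2\cdots w_m$ with every $w_i$ a palindrome (the palindromic length). For a positive integer $n$, $c[n]$ is the number of runs (maximal blocks of equal consecutive letters) in the binary expansion of $n$; e.g. $1000=(11111)(0)(1)(000)_2$ gives $c[1000]=4$. For $0\le t\le k$, the masque of type $A$ of length $k$ is the binary word $M^A_k(t)=0^t1^{k-t}$, and the associated masque operation $M^A_k(t):\{0,1\}^k\to\{0,1\}^k$ maps a word $q$ to the word whose $i$-th letter is $q[i]$ if $M^A_k(t)[i]=0$ and $1-q[i]$ if $M^A_k(t)[i]=1$ (i.e. it complements the letters in positions $t+1,\dots,k$). -}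

module Defs where

open import Data.Nat using (ℕ; zero; suc; _+_; _≤_; _/_; _%_; _≡ᵇ_)
open import Data.Bool using (Bool; true; false; not; if_then_else_)
open import Data.List using (List; []; _∷_; map; reverse; length; concat; replicate; upTo)
open import Data.List.Relation.Unary.All using (All)
open import Data.Product using (Σ; _×_; ∃)
open import Relation.Binary.PropositionalEquality using (_≡_)

-- 2-adic valuation with fuel; fuel n suffices for n ≥ 1.
ν₂-fuel : ℕ → ℕ → ℕ
ν₂-fuel zero    _ = 0
ν₂-fuel (suc f) zero = 0
ν₂-fuel (suc f) (suc m) =
  if ((suc m) % 2) ≡ᵇ 0 then suc (ν₂-fuel f ((suc m) / 2)) else 0

-- ruler sequence: a[n] = ν₂(n)   (meaningful for n ≥ 1)
ruler : ℕ → ℕ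
ruler n = ν₂-fuel n n

rulerPrefix : ℕ → List ℕ
rulerPrefix n = map (λ i → ruler (suc i)) (upTo n)

IsPalindrome : {A : Set} → List A → Set
IsPalindrome w = w ≡ reverse w

PalFactorization : {A : Set} → List A → ℕ → Set
PalFactorization {A} w m =
  Σ (List (List A)) λ ws → length ws ≡ m × concat ws ≡ w × All IsPalindrome ws

IsPalLength : {A : Set} → List A → ℕ → Set
IsPalLength w m = PalFactorization w m × (∀ m' → PalFactorization w m' → m ≤ m')

-- binary expansion, least significant bit first (fuel-based); true = 1
binRev-fuel : ℕ → ℕ → List Bool
binRev-fuel zero    _ = []
binRev-fuel (suc f) zero = []
binRev-fuel (suc f) (suc m) = ((suc m) % 2 ≡ᵇ 1) ∷ binRev-fuel f ((suc m) / 2)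

binary : ℕ → List Bool
binary n = reverse (binRev-fuel n n)

runs : List Bool → ℕ
runs [] = 0
runs (x ∷ []) = 1
runs (x ∷ y ∷ xs) = (if x ≡ᵇ' y then 0 else 1) + runs (y ∷ xs)
  where
  _≡ᵇ'_ : Bool → Bool → Bool
  true  ≡ᵇ' true  = true
  false ≡ᵇ' false = true
  _     ≡ᵇ' _     = false

c : ℕ → ℕ
c n = runs (binary n)

masqueA : ℕ → List Bool → List Bool
masqueA zero    q = map not q
masqueA (suc t) [] = []
masqueA (suc t) (x ∷ q) = x ∷ masqueA t q

applyMasques : List ℕ → List Bool → List Bool
applyMasques []       q = q
applyMasques (t ∷ ts) q = applyMasques ts (masqueA t q)

MasqueReach : List Bool → ℕ → Set
MasqueReach p m =
  Σ (List ℕ) λ ts → length ts ≡ m × All (λ t → t ≤ length p) ts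
    × applyMasques ts p ≡ replicate (length p) false

IsMinMasqueCount : List Bool → ℕ → Set
IsMinMasqueCount p m = MasqueReach p m × (∀ m' → MasqueReach p m' → m ≤ m')

-- Let c n be read as the number of switches between adjacent letters of 0·bin(n); then
-- c (b + 2m) = [b ≠ m mod 2] + c m.  A masque operation of type A changes this switch count
-- by at most one, and complementing from each switch onwards reaches 0^k, so c n is the
-- minimal number of masque operations.  Since a[2i+1] = 0 and a[2i] = a[i] + 1, a nonempty
-- palindromic factor a[x+1, x+l] of the ruler word has odd length and, with its ends halved,
-- comes from a palindromic factor at position ⌊x/2⌋; by induction along this halving it raises
-- c of its end position by at most one, so every palindromic factorization of a[1,n] has at
-- least c n factors.  Conversely, doubling a factorization of a[1,m] into c m palindromes gives
-- one of a[1, 2m + b], prefixed by the single letter a[1] exactly when the last bit changes.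

module Submission where

open import Defs
open import Data.Bool using (Bool; true; false; not; _xor_; if_then_else_)
open import Data.Bool.Properties using (not-involutive; not-distribˡ-xor; not-distribʳ-xor; xor-same; xor-comm; xor-assoc)
open import Data.Empty using (⊥-elim)
open import Data.List using (List; []; _∷_; _++_; _∷ʳ_; length; map; reverse; concat; replicate; applyUpTo; applyDownFrom)
open import Data.List.Properties using (unfold-reverse; reverse-applyUpTo; map-upTo; ∷-injective; length-map)
open import Data.List.Relation.Unary.All using (All; []; _∷_)
import Data.List.Relation.Unary.All as All
open import Data.List.Relation.Unary.All.Properties using (map⁺)
open import Data.Nat using (ℕ; zero; suc; pred; _+_; _*_; _∸_; _≤_; _<_; _/_; _%_; z≤n; s≤s; _≡ᵇ_)
open import Data.Nat.Properties
open import Data.Nat.DivMod using (m*n%n≡0; m*n/n≡m; [m+kn]%n≡m%n; +-distrib-/-∣ʳ; m/n<m)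
open import Data.Nat.Divisibility using (n∣m*n)
open import Data.Nat.Induction using (<-rec; <-wellFounded)
open import Induction.WellFounded using (Acc; acc)
open import Data.Product using (Σ; _×_; _,_; proj₁; proj₂)
open import Function using (_∘_; _⇔_; mk⇔; Equivalence)
open import Relation.Nullary using (¬_)
open import Relation.Binary.PropositionalEquality

open Equivalence using (to; from)

private
  variable
    A : Set

-- The ruler sequence and binary expansions at 2m and 2m + 1

2*m%2≡0 : ∀ m → 2 * m % 2 ≡ 0
2*m%2≡0 m = trans (cong (_% 2) (*-comm 2 m)) (m*n%n≡0 m 2)

2*m/2≡m : ∀ m → 2 * m / 2 ≡ m
2*m/2≡m m = trans (cong (_/ 2) (*-comm 2 m)) (m*n/n≡m m 2)

[1+2*m]%2≡1 : ∀ m → suc (2 * m) % 2 ≡ 1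
[1+2*m]%2≡1 m = trans (cong (λ n → suc n % 2) (*-comm 2 m)) ([m+kn]%n≡m%n 1 m 2)

[1+2*m]/2≡m : ∀ m → suc (2 * m) / 2 ≡ m
[1+2*m]/2≡m m = begin
  (1 + 2 * m) / 2     ≡⟨ cong (λ n → (1 + n) / 2) (*-comm 2 m) ⟩
  (1 + m * 2) / 2     ≡⟨ +-distrib-/-∣ʳ 1 {d = 2} (n∣m*n m) ⟩
  1 / 2 + m * 2 / 2   ≡⟨ m*n/n≡m m 2 ⟩
  m                   ∎
  where open ≡-Reasoning

[1+m]/2≤m : ∀ m → suc m / 2 ≤ m
[1+m]/2≤m m = <⇒≤pred (m/n<m (suc m) 2 (s≤s (s≤s z≤n)))

1+m≤pred[2[1+m]] : ∀ m → suc m ≤ pred (2 * suc m)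
1+m≤pred[2[1+m]] m = ≤-trans (s≤s (m≤m+n m (m + 0))) (≤-reflexive (sym (+-suc m (m + 0))))

ν₂-fuel-stable : ∀ f g n → n ≤ f → n ≤ g → ν₂-fuel f n ≡ ν₂-fuel g n
ν₂-fuel-stable zero    zero    zero    _ _ = refl
ν₂-fuel-stable zero    (suc g) zero    _ _ = refl
ν₂-fuel-stable (suc f) zero    zero    _ _ = refl
ν₂-fuel-stable (suc f) (suc g) zero    _ _ = refl
ν₂-fuel-stable (suc f) (suc g) (suc n) (s≤s n≤f) (s≤s n≤g) =
  cong (λ v → if suc n % 2 ≡ᵇ 0 then suc v else 0)
    (ν₂-fuel-stable f g (suc n / 2) (≤-trans ([1+m]/2≤m n) n≤f) (≤-trans ([1+m]/2≤m n) n≤g))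

binRev-fuel-stable : ∀ f g n → n ≤ f → n ≤ g → binRev-fuel f n ≡ binRev-fuel g n
binRev-fuel-stable zero    zero    zero    _ _ = refl
binRev-fuel-stable zero    (suc g) zero    _ _ = refl
binRev-fuel-stable (suc f) zero    zero    _ _ = refl
binRev-fuel-stable (suc f) (suc g) zero    _ _ = refl
binRev-fuel-stable (suc f) (suc g) (suc n) (s≤s n≤f) (s≤s n≤g) =
  cong (_ ∷_)
    (binRev-fuel-stable f g (suc n / 2) (≤-trans ([1+m]/2≤m n) n≤f) (≤-trans ([1+m]/2≤m n) n≤g))

ruler-odd : ∀ m → ruler (suc (2 * m)) ≡ 0
ruler-odd m rewrite [1+2*m]%2≡1 m = refl

ruler-even : ∀ m → ruler (2 * suc m) ≡ suc (ruler (suc m))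
ruler-even m rewrite 2*m%2≡0 (suc m) | 2*m/2≡m (suc m) =
  cong suc (ν₂-fuel-stable (pred (2 * suc m)) (suc m) (suc m) (1+m≤pred[2[1+m]] m) ≤-refl)

binRev : ℕ → List Bool
binRev n = binRev-fuel n n

binRev-1+2* : ∀ m → binRev (suc (2 * m)) ≡ true ∷ binRev m
binRev-1+2* m rewrite [1+2*m]%2≡1 m | [1+2*m]/2≡m m =
  cong (true ∷_) (binRev-fuel-stable (2 * m) m m (m≤m+n m (m + 0)) ≤-refl)

binRev-2*suc : ∀ m → binRev (2 * suc m) ≡ false ∷ binRev (suc m)
binRev-2*suc m rewrite 2*m%2≡0 (suc m) | 2*m/2≡m (suc m) =
  cong (false ∷_) (binRev-fuel-stable (pred (2 * suc m)) (suc m) (suc m) (1+m≤pred[2[1+m]] m) ≤-refl)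

binary-1+2* : ∀ m → binary (suc (2 * m)) ≡ binary m ∷ʳ true
binary-1+2* m = trans (cong reverse (binRev-1+2* m)) (unfold-reverse true (binRev m))

binary-2*suc : ∀ m → binary (2 * suc m) ≡ binary (suc m) ∷ʳ false
binary-2*suc m = trans (cong reverse (binRev-2*suc m)) (unfold-reverse false (binRev (suc m)))

data Half : ℕ → Set where
  twice   : ∀ m → Half (2 * m)
  twice+1 : ∀ m → Half (suc (2 * m))

half : ∀ n → Half n
half zero = twice 0
half (suc n) with half n
... | twice m   = twice+1 m
... | twice+1 m = subst Half (*-suc 2 m) (twice (suc m))

binary-ind : (P : ℕ → Set) → P 0 → (∀ m → P m → P (suc (2 * m))) →
             (∀ m → P (suc m) → P (2 * suc m)) → ∀ n → P n
binary-ind P P0 P1+2* P2*suc = <-rec P step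
  where
  step : ∀ n → (∀ {k} → k < n → P k) → P n
  step n rec with half n
  ... | twice zero    = P0
  ... | twice (suc m) = P2*suc m (rec (m<m+n (suc m) (s≤s z≤n)))
  ... | twice+1 m     = P1+2* m (rec (s≤s (m≤m+n m (m + 0))))

odd : ℕ → Bool
odd zero    = false
odd (suc n) = not (odd n)

odd-+ : ∀ m n → odd (m + n) ≡ odd m xor odd n
odd-+ zero    n = refl
odd-+ (suc m) n = trans (cong not (odd-+ m n)) (not-distribˡ-xor (odd m) (odd n))

odd-+-odd : ∀ m {n} → odd n ≡ true → odd (m + n) ≡ not (odd m)
odd-+-odd m {n} oddn = trans (odd-+ m n) (trans (cong (odd m xor_) oddn) (xor-comm (odd m) true))

odd-2* : ∀ m → odd (2 * m) ≡ false
odd-2* m = trans (odd-+ m (m + 0)) (trans (cong (λ k → odd m xor odd k) (+-identityʳ m)) (xor-same (odd m)))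

bit : Bool → ℕ
bit false = 0
bit true  = 1

odd-bit : ∀ b → odd (bit b) ≡ b
odd-bit false = refl
odd-bit true  = refl

2m+[1+2n]≡1+2[m+n] : ∀ m n → 2 * m + suc (2 * n) ≡ suc (2 * (m + n))
2m+[1+2n]≡1+2[m+n] m n = trans (+-suc (2 * m) (2 * n)) (cong suc (sym (*-distribˡ-+ 2 m n)))

[1+2m]+[1+2n]≡2[m+1+n] : ∀ m n → suc (2 * m) + suc (2 * n) ≡ 2 * (m + suc n)
[1+2m]+[1+2n]≡2[m+1+n] m n = begin
  suc (2 * m + suc (2 * n))  ≡⟨ cong suc (2m+[1+2n]≡1+2[m+n] m n) ⟩
  2 + 2 * (m + n)            ≡⟨ *-suc 2 (m + n) ⟨
  2 * suc (m + n)            ≡⟨ cong (2 *_) (+-suc m n) ⟨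
  2 * (m + suc n)            ∎
  where open ≡-Reasoning

m+n<2m+[1+2n] : ∀ m n → m + n < 2 * m + suc (2 * n)
m+n<2m+[1+2n] m n = subst (m + n <_) (sym (+-suc (2 * m) (2 * n)))
  (s≤s (+-mono-≤ (m≤m+n m (m + 0)) (m≤m+n n (n + 0))))

m+[1+n]<[1+2m]+[1+2n] : ∀ m n → m + suc n < suc (2 * m) + suc (2 * n)
m+[1+n]<[1+2m]+[1+2n] m n = s≤s (subst (_≤ 2 * m + suc (2 * n)) (sym (+-suc m n)) (m+n<2m+[1+2n] m n))

-- Switches and masque operations

switches : Bool → List Bool → ℕ
switches b []      = 0
switches b (x ∷ p) = bit (b xor x) + switches x p

lastOf : Bool → List Bool → Bool
lastOf b []      = b
lastOf b (x ∷ p) = lastOf x p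

switches-∷ʳ : ∀ b p x → switches b (p ∷ʳ x) ≡ switches b p + bit (lastOf b p xor x)
switches-∷ʳ b []      x = +-identityʳ (bit (b xor x))
switches-∷ʳ b (y ∷ p) x =
  trans (cong (bit (b xor y) +_) (switches-∷ʳ y p x)) (sym (+-assoc (bit (b xor y)) _ _))

lastOf-∷ʳ : ∀ b p x → lastOf b (p ∷ʳ x) ≡ x
lastOf-∷ʳ b []      x = refl
lastOf-∷ʳ b (y ∷ p) x = lastOf-∷ʳ y p x

odd-switches : ∀ b p → odd (switches b p) ≡ b xor lastOf b p
odd-switches b []      = sym (xor-same b)
odd-switches b (x ∷ p) = begin
  odd (bit (b xor x) + switches x p)          ≡⟨ odd-+ (bit (b xor x)) (switches x p) ⟩
  odd (bit (b xor x)) xor odd (switches x p)  ≡⟨ cong₂ _xor_ (odd-bit (b xor x)) (odd-switches x p) ⟩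
  (b xor x) xor (x xor l)                     ≡⟨ xor-assoc b x (x xor l) ⟩
  b xor (x xor (x xor l))                     ≡⟨ cong (b xor_) (sym (xor-assoc x x l)) ⟩
  b xor ((x xor x) xor l)                     ≡⟨ cong (λ y → b xor (y xor l)) (xor-same x) ⟩
  b xor l                                     ∎
  where
  open ≡-Reasoning
  l = lastOf x p

runs-switches : ∀ x q → runs (x ∷ q) ≡ suc (switches x q)
runs-switches x     []          = refl
runs-switches true  (true ∷ q)  = runs-switches true q
runs-switches true  (false ∷ q) = cong suc (runs-switches false q)
runs-switches false (true ∷ q)  = cong suc (runs-switches true q)
runs-switches false (false ∷ q) = runs-switches false q

binary-head : ∀ n → 1 ≤ n → Σ (List Bool) λ q → binary n ≡ true ∷ q
binary-head = binary-ind Leading1 (λ ()) P1+2* P2*suc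
  where
  Leading1 : ℕ → Set
  Leading1 n = 1 ≤ n → Σ (List Bool) λ q → binary n ≡ true ∷ q
  P1+2* : ∀ m → Leading1 m → Leading1 (suc (2 * m))
  P1+2* zero    _  _ = [] , refl
  P1+2* (suc m) ih _ with ih (s≤s z≤n)
  ... | q , e = q ∷ʳ true , trans (binary-1+2* (suc m)) (cong (_∷ʳ true) e)
  P2*suc : ∀ m → Leading1 (suc m) → Leading1 (2 * suc m)
  P2*suc m ih _ with ih (s≤s z≤n)
  ... | q , e = q ∷ʳ false , trans (binary-2*suc m) (cong (_∷ʳ false) e)

c≡switches : ∀ n → c n ≡ switches false (binary n)
c≡switches zero    = refl
c≡switches (suc n) with binary-head (suc n) (s≤s z≤n)
... | q , e = trans (cong runs e) (trans (runs-switches true q) (cong (switches false) (sym e)))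

lastOf-binary : ∀ n → lastOf false (binary n) ≡ odd n
lastOf-binary n with half n
... | twice zero    = refl
... | twice (suc m) = trans (cong (lastOf false) (binary-2*suc m))
                        (trans (lastOf-∷ʳ false (binary (suc m)) false) (sym (odd-2* (suc m))))
... | twice+1 m     = trans (cong (lastOf false) (binary-1+2* m))
                        (trans (lastOf-∷ʳ false (binary m) true) (sym (cong not (odd-2* m))))

odd-c : ∀ n → odd (c n) ≡ odd n
odd-c n = trans (cong odd (c≡switches n)) (trans (odd-switches false (binary n)) (lastOf-binary n))

c-∷ʳ : ∀ {n} m x → binary n ≡ binary m ∷ʳ x → c n ≡ bit (x xor odd m) + c m
c-∷ʳ {n} m x e = begin
  c n                                                  ≡⟨ c≡switches n ⟩
  switches false (binary n)                            ≡⟨ cong (switches false) e ⟩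
  switches false (binary m ∷ʳ x)                       ≡⟨ switches-∷ʳ false (binary m) x ⟩
  switches false (binary m) + bit (lastOf false (binary m) xor x)
    ≡⟨ cong₂ (λ s l → s + bit (l xor x)) (sym (c≡switches m)) (lastOf-binary m) ⟩
  c m + bit (odd m xor x)                              ≡⟨ +-comm (c m) _ ⟩
  bit (odd m xor x) + c m                              ≡⟨ cong (λ y → bit y + c m) (xor-comm (odd m) x) ⟩
  bit (x xor odd m) + c m                              ∎
  where open ≡-Reasoning

c-bit+2* : ∀ b m → c (bit b + 2 * m) ≡ bit (b xor odd m) + c m
c-bit+2* true  m       = c-∷ʳ {suc (2 * m)} m true (binary-1+2* m)
c-bit+2* false zero    = refl
c-bit+2* false (suc m) = c-∷ʳ {2 * suc m} (suc m) false (binary-2*suc m)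

switches-map-not : ∀ b p → switches b (map not p) ≡ switches (not b) p
switches-map-not b []      = refl
switches-map-not b (x ∷ p) = cong₂ _+_
  (cong bit (trans (sym (not-distribʳ-xor b x)) (not-distribˡ-xor b x)))
  (trans (switches-map-not (not x) p) (cong (λ y → switches y p) (not-involutive x)))

switches≤1+switches-not : ∀ b p → switches b p ≤ suc (switches (not b) p)
switches≤1+switches-not b     []          = z≤n
switches≤1+switches-not true  (true ∷ p)  = ≤-trans (n≤1+n _) (n≤1+n _)
switches≤1+switches-not true  (false ∷ p) = ≤-refl
switches≤1+switches-not false (true ∷ p)  = ≤-refl
switches≤1+switches-not false (false ∷ p) = ≤-trans (n≤1+n _) (n≤1+n _)

switches≤1+switches-masqueA : ∀ t b p → switches b p ≤ suc (switches b (masqueA t p))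
switches≤1+switches-masqueA zero    b p =
  subst (λ s → switches b p ≤ suc s) (sym (switches-map-not b p)) (switches≤1+switches-not b p)
switches≤1+switches-masqueA (suc t) b []      = z≤n
switches≤1+switches-masqueA (suc t) b (x ∷ p) =
  subst (bit (b xor x) + switches x p ≤_) (+-suc (bit (b xor x)) _)
    (+-monoʳ-≤ (bit (b xor x)) (switches≤1+switches-masqueA t x p))

switches≤length+switches-applyMasques : ∀ ts b p → switches b p ≤ length ts + switches b (applyMasques ts p)
switches≤length+switches-applyMasques []       b p = ≤-refl
switches≤length+switches-applyMasques (t ∷ ts) b p =
  ≤-trans (switches≤1+switches-masqueA t b p)
    (s≤s (switches≤length+switches-applyMasques ts b (masqueA t p)))

switches-replicate-false : ∀ k → switches false (replicate k false) ≡ 0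
switches-replicate-false zero    = refl
switches-replicate-false (suc k) = switches-replicate-false k

masqueReach⇒switches≤ : ∀ {p m} → MasqueReach p m → switches false p ≤ m
masqueReach⇒switches≤ {p} (ts , refl , _ , reached) = begin
  switches false p
    ≤⟨ switches≤length+switches-applyMasques ts false p ⟩
  length ts + switches false (applyMasques ts p)
    ≡⟨ cong (λ q → length ts + switches false q) reached ⟩
  length ts + switches false (replicate (length p) false)
    ≡⟨ cong (length ts +_) (switches-replicate-false (length p)) ⟩
  length ts + 0
    ≡⟨ +-identityʳ (length ts) ⟩
  length ts
    ∎
  where open ≤-Reasoning

applyMasques-map-suc : ∀ ts x q → applyMasques (map suc ts) (x ∷ q) ≡ x ∷ applyMasques ts q
applyMasques-map-suc []       x q = refl
applyMasques-map-suc (t ∷ ts) x q = applyMasques-map-suc ts x (masqueA t q)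

masqueReach-false∷ : ∀ {q m} → MasqueReach q m → MasqueReach (false ∷ q) m
masqueReach-false∷ {q} (ts , refl , bounded , reached) =
  map suc ts , length-map suc ts , map⁺ (All.map s≤s bounded) ,
  trans (applyMasques-map-suc ts false q) (cong (false ∷_) reached)

masqueReach-true∷ : ∀ {q m} → MasqueReach (map not q) m → MasqueReach (true ∷ q) (suc m)
masqueReach-true∷ {q} r with masqueReach-false∷ r
... | ts , len , bounded , reached =
  0 ∷ ts , cong suc len ,
  z≤n ∷ All.map (λ {t} t≤ → subst (t ≤_) (cong suc (length-map not q)) t≤) bounded ,
  trans reached (cong (λ k → replicate (suc k) false) (length-map not q))

masqueReach-switches : ∀ q → MasqueReach q (switches false q) × MasqueReach (map not q) (switches true q)
masqueReach-switches [] = ([] , refl , [] , refl) , ([] , refl , [] , refl)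
masqueReach-switches (true ∷ q) with masqueReach-switches q
... | _ , r¬ = masqueReach-true∷ r¬ , masqueReach-false∷ r¬
masqueReach-switches (false ∷ q) with masqueReach-switches q
... | r , _ =
  masqueReach-false∷ r ,
  masqueReach-true∷ (subst (λ p → MasqueReach p (switches false q)) (sym (map-not-not q)) r)
  where
  map-not-not : ∀ q → map not (map not q) ≡ q
  map-not-not []      = refl
  map-not-not (x ∷ q) = cong₂ _∷_ (not-involutive x) (map-not-not q)

isMinMasqueCount-switches : ∀ p → IsMinMasqueCount p (switches false p)
isMinMasqueCount-switches p = proj₁ (masqueReach-switches p) , λ m r → masqueReach⇒switches≤ r

applyUpTo-cong : ∀ {f g : ℕ → A} n → (∀ {t} → t < n → f t ≡ g t) → applyUpTo f n ≡ applyUpTo g n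
applyUpTo-cong zero    _   = refl
applyUpTo-cong (suc n) f≡g = cong₂ _∷_ (f≡g (s≤s z≤n)) (applyUpTo-cong n (f≡g ∘ s≤s))

applyUpTo-cong⁻ : ∀ {f g : ℕ → A} n → applyUpTo f n ≡ applyUpTo g n → ∀ {t} → t < n → f t ≡ g t
applyUpTo-cong⁻ (suc n) e {zero}  _         = proj₁ (∷-injective e)
applyUpTo-cong⁻ (suc n) e {suc t} (s≤s t<n) = applyUpTo-cong⁻ n (proj₂ (∷-injective e)) t<n

applyUpTo-++ : ∀ (f : ℕ → A) m n → applyUpTo f (m + n) ≡ applyUpTo f m ++ applyUpTo (f ∘ (m +_)) n
applyUpTo-++ f zero    n = refl
applyUpTo-++ f (suc m) n = cong (f 0 ∷_) (applyUpTo-++ (f ∘ suc) m n)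

++≡applyUpTo⁻ : ∀ (f : ℕ → A) w r n → w ++ r ≡ applyUpTo f n →
  Σ ℕ λ d → length w + d ≡ n × w ≡ applyUpTo f (length w) × r ≡ applyUpTo (f ∘ (length w +_)) d
++≡applyUpTo⁻ f []      r n       e = n , refl , refl , e
++≡applyUpTo⁻ f (a ∷ w) r zero    ()
++≡applyUpTo⁻ f (a ∷ w) r (suc n) e with ∷-injective e
... | a≡ , e′ with ++≡applyUpTo⁻ (f ∘ suc) w r n e′
... | d , len , w≡ , r≡ = d , cong suc len , cong₂ _∷_ a≡ w≡ , r≡

applyDownFrom≡applyUpTo : ∀ (f : ℕ → A) n → applyDownFrom f n ≡ applyUpTo (λ t → f (n ∸ suc t)) n
applyDownFrom≡applyUpTo f zero    = refl
applyDownFrom≡applyUpTo f (suc n) = cong (f n ∷_) (applyDownFrom≡applyUpTo f n)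

Palindromic : (ℕ → A) → ℕ → Set
Palindromic f l = ∀ t u → suc (t + u) ≡ l → f t ≡ f u

palindromic-const : ∀ {f : ℕ → A} {a} l → (∀ t → f t ≡ a) → Palindromic f l
palindromic-const l f≡a t u _ = trans (f≡a t) (sym (f≡a u))

palindromic-1 : ∀ (f : ℕ → A) → Palindromic f 1
palindromic-1 f zero    zero    _  = refl
palindromic-1 f zero    (suc u) ()
palindromic-1 f (suc t) u       ()

palindromic-injective : ∀ {B : Set} {f : ℕ → A} {g : ℕ → B} (h : A → B) l →
  (∀ {a b} → h a ≡ h b → a ≡ b) → (∀ t → g t ≡ h (f t)) → Palindromic g l ⇔ Palindromic f l
palindromic-injective h l h-inj g≡hf = mk⇔
  (λ P t u e → h-inj (trans (sym (g≡hf t)) (trans (P t u e) (g≡hf u))))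
  (λ P t u e → trans (g≡hf t) (trans (cong h (P t u e)) (sym (g≡hf u))))

isPalindrome-applyUpTo : ∀ (f : ℕ → A) n → IsPalindrome (applyUpTo f n) ⇔ Palindromic f n
isPalindrome-applyUpTo f n = mk⇔ ⇒ ⇐
  where
  reversed : reverse (applyUpTo f n) ≡ applyUpTo (λ t → f (n ∸ suc t)) n
  reversed = trans (reverse-applyUpTo f n) (applyDownFrom≡applyUpTo f n)
  ⇒ : IsPalindrome (applyUpTo f n) → Palindromic f n
  ⇒ pal t u e = trans (applyUpTo-cong⁻ n (trans pal reversed) (subst (t <_) e (s≤s (m≤m+n t u))))
                      (cong f (trans (cong (_∸ suc t) (sym e)) (m+n∸m≡n (suc t) u)))
  ⇐ : Palindromic f n → IsPalindrome (applyUpTo f n)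
  ⇐ P = trans (applyUpTo-cong n (λ {t} t<n → P t (n ∸ suc t) (m+[n∸m]≡n t<n))) (sym reversed)

palindromic-split : ∀ (f : ℕ → A) l →
  Palindromic f (suc (2 * l)) ⇔ (Palindromic (f ∘ (2 *_)) (suc l) × Palindromic (f ∘ suc ∘ (2 *_)) l)
palindromic-split f l = mk⇔ ⇒ ⇐
  where
  ⇒ : Palindromic f (suc (2 * l)) → Palindromic (f ∘ (2 *_)) (suc l) × Palindromic (f ∘ suc ∘ (2 *_)) l
  ⇒ P = (λ t u e → P (2 * t) (2 * u)
           (cong suc (trans (sym (*-distribˡ-+ 2 t u)) (cong (2 *_) (suc-injective e))))) ,
        (λ t u e → P (suc (2 * t)) (suc (2 * u))
           (cong suc (trans ([1+2m]+[1+2n]≡2[m+1+n] t u) (cong (2 *_) (trans (+-suc t u) e)))))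
  ⇐ : Palindromic (f ∘ (2 *_)) (suc l) × Palindromic (f ∘ suc ∘ (2 *_)) l → Palindromic f (suc (2 * l))
  ⇐ (E , O) t u e with half t | half u
  ... | twice t′ | twice u′ =
    E t′ u′ (cong suc (*-cancelˡ-≡ (t′ + u′) l 2 (trans (*-distribˡ-+ 2 t′ u′) (suc-injective e))))
  ... | twice+1 t′ | twice+1 u′ =
    O t′ u′ (trans (sym (+-suc t′ u′))
      (*-cancelˡ-≡ (t′ + suc u′) l 2 (trans (sym ([1+2m]+[1+2n]≡2[m+1+n] t′ u′)) (suc-injective e))))
  ... | twice t′ | twice+1 u′ =
    ⊥-elim (even≢odd l (t′ + u′) (sym (trans (sym (2m+[1+2n]≡1+2[m+n] t′ u′)) (suc-injective e))))
  ... | twice+1 t′ | twice u′ =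
    ⊥-elim (even≢odd l (t′ + u′) (sym (trans (cong suc (*-distribˡ-+ 2 t′ u′)) (suc-injective e))))

-- Palindromic factors of the ruler word

-- ruler₀ is the ruler word indexed from 0 (ruler₀ i = a[i+1]), so factor x d = a[x+1, x+d].
ruler₀ : ℕ → ℕ
ruler₀ i = ruler (suc i)

factor : ℕ → ℕ → List ℕ
factor x d = applyUpTo (ruler₀ ∘ (x +_)) d

ruler₀[2m+2n]≡0 : ∀ m n → ruler₀ (2 * m + 2 * n) ≡ 0
ruler₀[2m+2n]≡0 m n = trans (cong ruler₀ (sym (*-distribˡ-+ 2 m n))) (ruler-odd (m + n))

ruler₀[1+2m+1+2n]≡0 : ∀ m n → ruler₀ (suc (2 * m) + suc (2 * n)) ≡ 0
ruler₀[1+2m+1+2n]≡0 m n = trans (cong ruler₀ ([1+2m]+[1+2n]≡2[m+1+n] m n)) (ruler-odd (m + suc n))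

ruler₀[1+2m]≡1+ruler₀[m] : ∀ m → ruler₀ (suc (2 * m)) ≡ suc (ruler₀ m)
ruler₀[1+2m]≡1+ruler₀[m] m = trans (cong ruler (sym (*-suc 2 m))) (ruler-even m)

ruler₀[2m+1+2n]≡1+ruler₀[m+n] : ∀ m n → ruler₀ (2 * m + suc (2 * n)) ≡ suc (ruler₀ (m + n))
ruler₀[2m+1+2n]≡1+ruler₀[m+n] m n =
  trans (cong ruler₀ (2m+[1+2n]≡1+2[m+n] m n)) (ruler₀[1+2m]≡1+ruler₀[m] (m + n))

ruler₀[1+2m+2n]≡1+ruler₀[m+n] : ∀ m n → ruler₀ (suc (2 * m) + 2 * n) ≡ suc (ruler₀ (m + n))
ruler₀[1+2m+2n]≡1+ruler₀[m+n] m n =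
  trans (cong (ruler₀ ∘ suc) (sym (*-distribˡ-+ 2 m n))) (ruler₀[1+2m]≡1+ruler₀[m] (m + n))

palindromic-2* : ∀ x l →
  Palindromic (ruler₀ ∘ (x +_)) l ⇔ Palindromic (ruler₀ ∘ (2 * x +_)) (suc (2 * l))
palindromic-2* x l = mk⇔
  (λ P → from split (palindromic-const (suc l) (ruler₀[2m+2n]≡0 x) , from odd-part P))
  (λ P → to odd-part (proj₂ (to split P)))
  where
  split = palindromic-split (ruler₀ ∘ (2 * x +_)) l
  odd-part = palindromic-injective suc l suc-injective (ruler₀[2m+1+2n]≡1+ruler₀[m+n] x)

palindromic-1+2* : ∀ x l →
  Palindromic (ruler₀ ∘ (x +_)) (suc l) ⇔ Palindromic (ruler₀ ∘ (suc (2 * x) +_)) (suc (2 * l))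
palindromic-1+2* x l = mk⇔
  (λ P → from split (from even-part P , palindromic-const l (ruler₀[1+2m+1+2n]≡0 x)))
  (λ P → to even-part (proj₁ (to split P)))
  where
  split = palindromic-split (ruler₀ ∘ (suc (2 * x) +_)) l
  even-part = palindromic-injective suc (suc l) suc-injective (ruler₀[1+2m+2n]≡1+ruler₀[m+n] x)

¬palindromic-even : ∀ x k → ¬ Palindromic (ruler₀ ∘ (x +_)) (2 * suc k)
¬palindromic-even x k P with half x | P 0 (suc (2 * k)) (sym (*-suc 2 k))
... | twice x′   | ends = 0≢1+n (trans (sym (ruler₀[2m+2n]≡0 x′ 0))
                          (trans ends (ruler₀[2m+1+2n]≡1+ruler₀[m+n] x′ k)))
... | twice+1 x′ | ends = 0≢1+n (trans (sym (ruler₀[1+2m+1+2n]≡0 x′ k))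
                          (trans (sym ends) (ruler₀[1+2m+2n]≡1+ruler₀[m+n] x′ 0)))

palindromic-odd : ∀ x l → Palindromic (ruler₀ ∘ (x +_)) (suc l) → odd (suc l) ≡ true
palindromic-odd x l P with half l
... | twice m   = cong not (odd-2* m)
... | twice+1 m = ⊥-elim (¬palindromic-even x m (subst (Palindromic _) (sym (*-suc 2 m)) P))

c[1+2m]≤1+c[2m] : ∀ m → c (suc (2 * m)) ≤ suc (c (2 * m))
c[1+2m]≤1+c[2m] m = begin
  c (suc (2 * m))            ≡⟨ c-bit+2* true m ⟩
  bit (not (odd m)) + c m    ≤⟨ +-monoˡ-≤ (c m) (bit-not (odd m)) ⟩
  suc (bit (odd m) + c m)    ≡⟨ cong suc (c-bit+2* false m) ⟨
  suc (c (2 * m))            ∎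
  where
  open ≤-Reasoning
  bit-not : ∀ b → bit (not b) ≤ suc (bit b)
  bit-not false = ≤-refl
  bit-not true  = z≤n

c-bit+2*-mono : ∀ b b′ x y → b xor odd y ≡ b′ xor odd x → c y ≤ suc (c x) →
                c (bit b + 2 * y) ≤ suc (c (bit b′ + 2 * x))
c-bit+2*-mono b b′ x y same-bit cy≤ = begin
  c (bit b + 2 * y)               ≡⟨ c-bit+2* b y ⟩
  bit (b xor odd y) + c y         ≤⟨ +-monoʳ-≤ (bit (b xor odd y)) cy≤ ⟩
  bit (b xor odd y) + suc (c x)   ≡⟨ +-suc (bit (b xor odd y)) (c x) ⟩
  suc (bit (b xor odd y) + c x)   ≡⟨ cong (λ β → suc (bit β + c x)) same-bit ⟩
  suc (bit (b′ xor odd x) + c x)  ≡⟨ cong suc (c-bit+2* b′ x) ⟨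
  suc (c (bit b′ + 2 * x))        ∎
  where open ≤-Reasoning

-- The halved factor at ⌊x/2⌋ has odd length, so its ends have opposite parity and c gains
-- the same last-bit term at both ends of the original factor.
c-palindromic : ∀ x l → Palindromic (ruler₀ ∘ (x +_)) l → c (x + l) ≤ suc (c x)
c-palindromic x l = go x l (<-wellFounded (x + l))
  where
  go : ∀ x l → Acc _<_ (x + l) → Palindromic (ruler₀ ∘ (x +_)) l → c (x + l) ≤ suc (c x)
  go x l (acc rec) P with half l | half x
  ... | twice zero    | _ = ≤-trans (≤-reflexive (cong c (+-identityʳ x))) (n≤1+n (c x))
  ... | twice (suc k) | _ = ⊥-elim (¬palindromic-even x k P)
  ... | twice+1 zero | twice x′ =
    subst (λ n → c n ≤ suc (c (2 * x′))) (+-comm 1 (2 * x′)) (c[1+2m]≤1+c[2m] x′)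
  ... | twice+1 (suc k) | twice x′ =
    subst (λ n → c n ≤ suc (c (2 * x′))) (sym (2m+[1+2n]≡1+2[m+n] x′ (suc k)))
      (c-bit+2*-mono true false x′ (x′ + suc k)
        (trans (cong not (odd-+-odd x′ (palindromic-odd x′ k Q))) (not-involutive (odd x′)))
        (go x′ (suc k) (rec (m+n<2m+[1+2n] x′ (suc k))) Q))
    where Q = from (palindromic-2* x′ (suc k)) P
  ... | twice+1 j | twice+1 x′ =
    subst (λ n → c n ≤ suc (c (suc (2 * x′)))) (sym ([1+2m]+[1+2n]≡2[m+1+n] x′ j))
      (c-bit+2*-mono false true x′ (x′ + suc j) (odd-+-odd x′ (palindromic-odd x′ j Q))
        (go x′ (suc j) (rec (m+[1+n]<[1+2m]+[1+2n] x′ j)) Q))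
    where Q = from (palindromic-1+2* x′ j) P

-- Palindromic length

factor-shift : ∀ x k d → applyUpTo ((ruler₀ ∘ (x +_)) ∘ (k +_)) d ≡ factor (x + k) d
factor-shift x k d = applyUpTo-cong d (λ {t} _ → cong ruler₀ (sym (+-assoc x k t)))

factor-+ : ∀ x k d → factor x (k + d) ≡ factor x k ++ factor (x + k) d
factor-+ x k d = trans (applyUpTo-++ (ruler₀ ∘ (x +_)) k d) (cong (factor x k ++_) (factor-shift x k d))

c-factorization : ∀ x d ws → All IsPalindrome ws → concat ws ≡ factor x d → c (x + d) ≤ length ws + c x
c-factorization x zero    []       _            _ = ≤-reflexive (cong c (+-identityʳ x))
c-factorization x (suc d) []       _            ()
c-factorization x d       (w ∷ ws) (pal ∷ pals) e with ++≡applyUpTo⁻ (ruler₀ ∘ (x +_)) w (concat ws) d e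
... | d′ , refl , w≡ , rest = begin
  c (x + (k + d′))       ≡⟨ cong c (+-assoc x k d′) ⟨
  c (x + k + d′)         ≤⟨ c-factorization (x + k) d′ ws pals (trans rest (factor-shift x k d′)) ⟩
  length ws + c (x + k)  ≤⟨ +-monoʳ-≤ (length ws) (c-palindromic x k P) ⟩
  length ws + suc (c x)  ≡⟨ +-suc (length ws) (c x) ⟩
  suc (length ws + c x)  ∎
  where
  open ≤-Reasoning
  k = length w
  P = to (isPalindrome-applyUpTo (ruler₀ ∘ (x +_)) k) (subst IsPalindrome w≡ pal)

-- PalPath x y m: a[x+1, y] is a product of m nonempty palindromes.
data PalPath : ℕ → ℕ → ℕ → Set where
  []   : ∀ {x} → PalPath x x 0
  step : ∀ {x k y z m} → Palindromic (ruler₀ ∘ (x +_)) (suc k) → x + suc k ≡ y →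
         PalPath y z m → PalPath x z (suc m)

PalPath-2* : ∀ s {x y m} → PalPath x y m → PalPath (bit s + 2 * x) (bit (s xor odd m) + 2 * y) m
PalPath-2* false [] = []
PalPath-2* true  [] = []
PalPath-2* false (step {x} {k} P refl rest) =
  step (to (palindromic-2* x (suc k)) P) (2m+[1+2n]≡1+2[m+n] x (suc k)) (PalPath-2* true rest)
PalPath-2* true (step {x} {k} {z = z} {m} P refl rest) =
  step (to (palindromic-1+2* x k) P) ([1+2m]+[1+2n]≡2[m+1+n] x k)
    (subst (λ β → PalPath (2 * (x + suc k)) (bit β + 2 * z) m) (sym (not-involutive (odd m)))
      (PalPath-2* false rest))

PalPath-bit+2* : ∀ b m → PalPath 0 m (c m) → PalPath 0 (bit b + 2 * m) (c (bit b + 2 * m))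
PalPath-bit+2* b m p rewrite c-bit+2* b m = choose b (odd m) doubled (step (palindromic-1 _) refl doubled′)
  where
  doubled : PalPath 0 (bit (odd m) + 2 * m) (c m)
  doubled = subst (λ β → PalPath 0 (bit β + 2 * m) (c m)) (odd-c m) (PalPath-2* false p)
  doubled′ : PalPath 1 (bit (not (odd m)) + 2 * m) (c m)
  doubled′ = subst (λ β → PalPath 1 (bit β + 2 * m) (c m)) (cong not (odd-c m)) (PalPath-2* true p)
  choose : ∀ b β → PalPath 0 (bit β + 2 * m) (c m) → PalPath 0 (bit (not β) + 2 * m) (suc (c m)) →
           PalPath 0 (bit b + 2 * m) (bit (b xor β) + c m)
  choose false false same _    = same
  choose false true  _    flip = flip
  choose true  false _    flip = flip
  choose true  true  same _    = same

PalPath-c : ∀ n → PalPath 0 n (c n)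
PalPath-c = binary-ind (λ n → PalPath 0 n (c n)) [] (PalPath-bit+2* true) (λ m → PalPath-bit+2* false (suc m))

PalPath⇒factorization : ∀ {x y m} → PalPath x y m →
  Σ ℕ λ d → x + d ≡ y × PalFactorization (factor x d) m
PalPath⇒factorization {x} [] = 0 , +-identityʳ x , [] , refl , refl , []
PalPath⇒factorization {x} (step {k = k} P refl rest) with PalPath⇒factorization rest
... | d , refl , ws , len , cat , pals =
  suc k + d , sym (+-assoc x (suc k) d) , factor x (suc k) ∷ ws , cong suc len ,
  trans (cong (factor x (suc k) ++_) cat) (sym (factor-+ x (suc k) d)) ,
  from (isPalindrome-applyUpTo (ruler₀ ∘ (x +_)) (suc k)) P ∷ pals

isPalLength-factor : ∀ n → IsPalLength (factor 0 n) (c n)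
isPalLength-factor n with PalPath⇒factorization (PalPath-c n)
... | d , refl , fact = fact , λ m (ws , len , cat , pals) →
  subst (c d ≤_) (trans (+-identityʳ (length ws)) len) (c-factorization 0 d ws pals cat)

theorem1 : (n : ℕ) → 1 ≤ n →
    Σ ℕ λ m → IsPalLength (rulerPrefix n) m × IsMinMasqueCount (binary n) m × m ≡ c n
theorem1 n _ =
  c n ,
  subst (λ w → IsPalLength w (c n)) (sym (map-upTo ruler₀ n)) (isPalLength-factor n) ,
  subst (IsMinMasqueCount (binary n)) (sym (c≡switches n)) (isMinMasqueCount-switches (binary n)) ,
  refl
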